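{- Let $\ell$ be a prime, $n,k\in\mathbb{N}$ with $\ell>k\cdot n!+1$, and let $\rho:G_{\mathbb{Q}_\ell}\to\mathrm{GL}_n(\overline{\mathbb{F}}_\ell)$ be a Galois representation which is regular with tame inertia weights at most $k$. Then the $n!$-th powers of the $n$ characters on the diagonal of $\rho|_{I_\ell}$ (namely the characters $\psi_{r_i}^{b_i\ell^{j}}$, $1\le i\le s$, $0\le j\le r_i-1$, in the notation below) are pairwise distinct.
   Context: $I_\ell\subseteq G_{\mathbb{Q}_\ell}$ denotes the inertia group. Fix, for each $r\ge1$, a fundamental character $\psi_r:I_\ell\to\overline{\mathbb{F}}_\ell^\times$ of niveau $r$ (a character of the tame inertia group of order $\ell^r-1$, e.g. the reduction of $\sigma\mapsto\sigma(\varpi)/\varpi$ with $\varpi^{\ell^r-1}=\ell$, composed with an embedding of $\mathbb{F}_{\ell^r}$), chosen compatibly so that $\psi_{rs}^{(\ell^{rs}-1)/(\ell^r-1)}=\psi_r$ for all $r,s$. A representation $\rho:G_{\mathbb{Q}_\ell}\to\mathrm{GL}(V)$, $\dim V=n$ over $\overline{\mathbb{F}}_\ell$, is regular if there exist an integer $1\le s\le n$ and, for $i=1,\dots,s$, sets $S_i=\{a_{i,1},\dots,a_{i,r_i}\}\subseteq\{0,1,\dots,\ell-1\}$ of cardinality $r_i$ with $r_1+\dots+r_s=n$ and all $a_{i,j}$ distinct (so $S=S_1\cup\dots\cup S_s$ has $n$ elements), such that, with $b_i=a_{i,1}+a_{i,2}\ell+\dots+a_{i,r_i}\ell^{r_i-1}$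 and $B_i=\mathrm{diag}(\psi_{r_i}^{b_i},\psi_{r_i}^{b_i\ell},\dots,\psi_{r_i}^{b_i\ell^{r_i-1}})$, the restriction $\rho|_{I_\ell}$ is conjugate to a block upper triangular matrix with diagonal blocks $B_1,\dots,B_s$. The elements of $S$ are the tame inertia weights; $\rho$ has tame inertia weights at most $k$ if $S\subseteq\{0,1,\dots,k\}$. -}

module Defs where

open import Level using (Level)
open import Data.Nat using (ℕ; zero; suc; _+_; _*_; _^_; _∸_; _≤_; _<_)
open import Data.Nat.Divisibility using (_∣_)
open import Data.Fin using (Fin; toℕ) renaming (zero to fzero; suc to fsuc)
open import Data.Product using (Σ; _,_)
open import Function.Bundles using (_⇔_)
open import Relation.Nullary using (¬_)
open import Relation.Binary.PropositionalEquality using (_≡_)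
open import Algebra.Bundles using (AbelianGroup)

sumFin : (m : ℕ) → (Fin m → ℕ) → ℕ
sumFin zero    f = 0
sumFin (suc m) f = f fzero + sumFin m (λ j → f (fsuc j))

module _ {c ℓ' : Level} (G : AbelianGroup c ℓ') where
  open AbelianGroup G

  gpow : Carrier → ℕ → Carrier
  gpow x zero    = ε
  gpow x (suc m) = x ∙ gpow x m

  -- A compatible system of fundamental characters (ψ_r)_{r ≥ 1} inside
  -- the abelian group G of characters of the inertia group I_ℓ:
  -- ψ_r has order exactly ℓ^r − 1, and ψ_{rs}^{(ℓ^{rs}−1)/(ℓ^r−1)} = ψ_r.
  record FundamentalChars (ℓ : ℕ) (ψ : ℕ → Carrier) : Set (c Level.⊔ ℓ') where
    field
      order  : ∀ r → 1 ≤ r → ∀ m → (gpow (ψ r) m ≈ ε) ⇔ ((ℓ ^ r ∸ 1) ∣ m)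
      compat : ∀ r s q → 1 ≤ r → 1 ≤ s →
               q * (ℓ ^ r ∸ 1) ≡ ℓ ^ (r * s) ∸ 1 →
               gpow (ψ (r * s)) q ≈ ψ r

-- Data of a regular representation of dimension n with tame inertia
-- weights at most k (for prime ℓ): s blocks, block i of size r i ≥ 1,
-- with weights a i j (j < r i), all distinct, in {0,…,k} ⊆ {0,…,ℓ-1}.
record RegularData (ℓ n k : ℕ) : Set where
  field
    s        : ℕ
    s-pos    : 1 ≤ s
    s-le     : s ≤ n
    r        : Fin s → ℕ
    r-pos    : ∀ i → 1 ≤ r i
    r-sum    : sumFin s r ≡ n
    a        : (i : Fin s) → Fin (r i) → ℕ
    a<ℓ      : ∀ i j → a i j < ℓ
    a≤k      : ∀ i j → a i j ≤ k
    a-inj    : ∀ i j i' j' → a i j ≡ a i' j' →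
               _≡_ {A = Σ (Fin s) (λ i → Fin (r i))} (i , j) (i' , j')

  b : Fin s → ℕ
  b i = sumFin (r i) (λ j → a i j * ℓ ^ toℕ j)

diagChar : ∀ {c ℓ'} (G : AbelianGroup c ℓ') {ℓ n k : ℕ}
           (ψ : ℕ → AbelianGroup.Carrier G) (D : RegularData ℓ n k) →
           (i : Fin (RegularData.s D)) → Fin (RegularData.r D i) →
           AbelianGroup.Carrier G
diagChar G {ℓ} ψ D i j =
  gpow G (ψ (RegularData.r D i)) (RegularData.b D i * ℓ ^ toℕ j)

-- Put N = r_i r_i'. By compatibility ψ_{r_i} is ψ_N raised to (ℓ^N − 1)/(ℓ^{r_i} − 1), so the
-- n!-th power of the diagonal character (i, j) is ψ_N raised to ℓ^j times the base-ℓ numeral of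
-- length N whose digits are n!·a_{i, t mod r_i}, i.e. the block of weights of B_i repeated.
-- ψ_N has order M = ℓ^N − 1 and ℓ^N ≡ 1 (mod M), so multiplying by ℓ rotates the digits of such
-- a numeral cyclically modulo M. As k·n! + 1 < ℓ, all digits are at most ℓ − 2, so these numerals
-- are < M and a congruence between them is an equality of digit strings. Comparing one digit and
-- using that the weights are pairwise distinct forces (i, j) = (i', j').
module Submission where

open import Data.Nat
  using (ℕ; zero; suc; pred; _+_; _*_; _^_; _∸_; _≤_; _<_; _%_; _!
        ; z≤n; s≤s; z<s; s≤s⁻¹; NonZero; >-nonZero)
open import Data.Nat.Properties
open import Data.Nat.DivMod using (_mod_; %-remove-+ˡ; %-remove-+ʳ; %-distribˡ-*; m<n⇒m%n≡m)
open import Data.Nat.Divisibility using (_∣_; m∣m*n; ∣-refl)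
open import Data.Nat.Primality using (Prime)
open import Data.Nat.Tactic.RingSolver using (solve-∀)
open import Data.Fin using (Fin; toℕ) renaming (zero to fzero; suc to fsuc)
open import Data.Fin.Properties using (toℕ-injective; toℕ-fromℕ<; toℕ<n)
open import Data.Product using (Σ; _,_; proj₁; proj₂)
open import Data.Sum using (inj₁; inj₂)
open import Function using (_∘_)
open import Function.Bundles using (Equivalence)
open import Relation.Nullary using (¬_)
open import Relation.Binary.PropositionalEquality
  using (_≡_; refl; sym; trans; cong; cong₂; subst; module ≡-Reasoning)
open import Algebra.Bundles using (AbelianGroup)
import Algebra.Properties.Group as GroupProperties
import Algebra.Properties.Monoid.Mult as MonoidMult
import Relation.Binary.Reasoning.Setoid as SetoidReasoning

open import Defs

Periodic : ℕ → (ℕ → ℕ) → Set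
Periodic p f = ∀ t → f (p + t) ≡ f t

periodic-* : ∀ {p f} → Periodic p f → ∀ m → Periodic (p * m) f
periodic-* {p} {f} per zero    t = cong (λ q → f (q + t)) (*-zeroʳ p)
periodic-* {p} {f} per (suc m) t = begin
  f (p * suc m + t)   ≡⟨ cong (λ q → f (q + t)) (*-suc p m) ⟩
  f (p + p * m + t)   ≡⟨ cong f (+-assoc p (p * m) t) ⟩
  f (p + (p * m + t)) ≡⟨ per (p * m + t) ⟩
  f (p * m + t)       ≡⟨ periodic-* per m t ⟩
  f t                 ∎
  where open ≡-Reasoning

repunit : ℕ → ℕ → ℕ
repunit x zero    = 0
repunit x (suc s) = 1 + x * repunit x s

repunit-*-pred : ∀ x s → 1 ≤ x → repunit x s * (x ∸ 1) ≡ x ^ s ∸ 1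
repunit-*-pred (suc y) s _ = begin
  repunit (suc y) s * y                ≡⟨ m+n∸n≡m _ 1 ⟨
  repunit (suc y) s * y + 1 ∸ 1        ≡⟨ cong (_∸ 1) (+1-form s) ⟩
  suc y ^ s ∸ 1                        ∎
  where
  open ≡-Reasoning
  +1-form : ∀ s → repunit (suc y) s * y + 1 ≡ suc y ^ s
  +1-form zero    = refl
  +1-form (suc s) = trans (lemma (repunit (suc y) s) y) (cong (suc y *_) (+1-form s))
    where
    lemma : ∀ g y → (1 + suc y * g) * y + 1 ≡ suc y * (g * y + 1)
    lemma = solve-∀

sumFin-cong : ∀ m {g h : Fin m → ℕ} → (∀ j → g j ≡ h j) → sumFin m g ≡ sumFin m h
sumFin-cong zero    g≗h = refl
sumFin-cong (suc m) g≗h = cong₂ _+_ (g≗h fzero) (sumFin-cong m (λ j → g≗h (fsuc j)))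

sumFin-*ˡ : ∀ m c g → sumFin m (λ j → c * g j) ≡ c * sumFin m g
sumFin-*ˡ zero    c g = sym (*-zeroʳ c)
sumFin-*ˡ (suc m) c g =
  trans (cong (c * g fzero +_) (sumFin-*ˡ m c (λ j → g (fsuc j))))
        (sym (*-distribˡ-+ c (g fzero) _))

module Digits (ℓ : ℕ) where

  fromDigits : ℕ → (ℕ → ℕ) → ℕ
  fromDigits zero    f = 0
  fromDigits (suc N) f = f 0 + ℓ * fromDigits N (λ t → f (suc t))

  fromDigits-cong : ∀ N {f g} → (∀ t → f t ≡ g t) → fromDigits N f ≡ fromDigits N g
  fromDigits-cong zero    f≗g = refl
  fromDigits-cong (suc N) f≗g =
    cong₂ (λ x y → x + ℓ * y) (f≗g 0) (fromDigits-cong N (λ t → f≗g (suc t)))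

  fromDigits-scale : ∀ N c f → fromDigits N (λ t → c * f t) ≡ c * fromDigits N f
  fromDigits-scale zero    c f = sym (*-zeroʳ c)
  fromDigits-scale (suc N) c f =
    trans (cong (λ x → c * f 0 + ℓ * x) (fromDigits-scale N c (λ t → f (suc t))))
          (lemma c (f 0) ℓ (fromDigits N (λ t → f (suc t))))
    where
    lemma : ∀ c a l v → c * a + l * (c * v) ≡ c * (a + l * v)
    lemma = solve-∀

  fromDigits-+ : ∀ A B f →
    fromDigits (A + B) f ≡ fromDigits A f + ℓ ^ A * fromDigits B (λ t → f (A + t))
  fromDigits-+ zero    B f = sym (*-identityˡ _)
  fromDigits-+ (suc A) B f =
    trans (cong (λ x → f 0 + ℓ * x) (fromDigits-+ A B (λ t → f (suc t))))
          (lemma (f 0) ℓ (fromDigits A (λ t → f (suc t))) (ℓ ^ A)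
                 (fromDigits B (λ t → f (suc A + t))))
    where
    lemma : ∀ a l u p v → a + l * (u + p * v) ≡ a + l * u + l * p * v
    lemma = solve-∀

  sumFin-≡-fromDigits : ∀ N f → sumFin N (λ j → f (toℕ j) * ℓ ^ toℕ j) ≡ fromDigits N f
  sumFin-≡-fromDigits zero    f = refl
  sumFin-≡-fromDigits (suc N) f = begin
    f 0 * 1 + sumFin N (λ j → f (suc (toℕ j)) * (ℓ * ℓ ^ toℕ j))
      ≡⟨ cong₂ _+_ (*-identityʳ (f 0))
                   (sumFin-cong N (λ j → lemma (f (suc (toℕ j))) ℓ (ℓ ^ toℕ j))) ⟩
    f 0 + sumFin N (λ j → ℓ * (f (suc (toℕ j)) * ℓ ^ toℕ j))
      ≡⟨ cong (f 0 +_) (sumFin-*ˡ N ℓ _) ⟩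
    f 0 + ℓ * sumFin N (λ j → f (suc (toℕ j)) * ℓ ^ toℕ j)
      ≡⟨ cong (λ v → f 0 + ℓ * v) (sumFin-≡-fromDigits N (λ t → f (suc t))) ⟩
    fromDigits (suc N) f ∎
    where
    open ≡-Reasoning
    lemma : ∀ a l p → a * (l * p) ≡ l * (a * p)
    lemma = solve-∀

  fromDigits-periodic : ∀ r m f → Periodic r f →
    fromDigits (r * m) f ≡ fromDigits r f * repunit (ℓ ^ r) m
  fromDigits-periodic r zero f per =
    trans (cong (λ N → fromDigits N f) (*-zeroʳ r)) (sym (*-zeroʳ (fromDigits r f)))
  fromDigits-periodic r (suc m) f per = begin
    fromDigits (r * suc m) f
      ≡⟨ cong (λ N → fromDigits N f) (*-suc r m) ⟩
    fromDigits (r + r * m) f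
      ≡⟨ fromDigits-+ r (r * m) f ⟩
    V + ℓ ^ r * fromDigits (r * m) (λ t → f (r + t))
      ≡⟨ cong (λ x → V + ℓ ^ r * x) (fromDigits-cong (r * m) per) ⟩
    V + ℓ ^ r * fromDigits (r * m) f
      ≡⟨ cong (λ x → V + ℓ ^ r * x) (fromDigits-periodic r m f per) ⟩
    V + ℓ ^ r * (V * repunit (ℓ ^ r) m)
      ≡⟨ lemma V (ℓ ^ r) (repunit (ℓ ^ r) m) ⟩
    V * repunit (ℓ ^ r) (suc m) ∎
    where
    open ≡-Reasoning
    V = fromDigits r f
    lemma : ∀ v x g → v + x * (v * g) ≡ v * (1 + x * g)
    lemma = solve-∀

  fromDigits-rotate : ∀ N f →
    fromDigits N f + ℓ ^ N * f N ≡ f 0 + ℓ * fromDigits N (λ t → f (suc t))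
  fromDigits-rotate N f = begin
    fromDigits N f + ℓ ^ N * f N
      ≡⟨ cong (λ x → fromDigits N f + ℓ ^ N * x) lastDigit ⟩
    fromDigits N f + ℓ ^ N * fromDigits 1 (λ t → f (N + t))
      ≡⟨ fromDigits-+ N 1 f ⟨
    fromDigits (N + 1) f
      ≡⟨ cong (λ M → fromDigits M f) (+-comm N 1) ⟩
    fromDigits (suc N) f ∎
    where
    open ≡-Reasoning
    lastDigit : f N ≡ f (N + 0) + ℓ * 0
    lastDigit = sym (trans (cong₂ _+_ (cong f (+-identityʳ N)) (*-zeroʳ ℓ)) (+-identityʳ (f N)))

  horner-< : ∀ {d F} N → d < ℓ → F < ℓ ^ N → d + ℓ * F < ℓ ^ suc N
  horner-< {d} {F} N d<ℓ F<ℓ^N = begin-strict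
    d + ℓ * F  <⟨ +-monoˡ-< (ℓ * F) d<ℓ ⟩
    ℓ + ℓ * F  ≡⟨ *-suc ℓ F ⟨
    ℓ * suc F  ≤⟨ *-monoʳ-≤ ℓ F<ℓ^N ⟩
    ℓ ^ suc N  ∎
    where open ≤-Reasoning

  fromDigits-< : ∀ N {f} → (∀ t → f t < ℓ) → fromDigits N f < ℓ ^ N
  fromDigits-< zero    f<ℓ = s≤s z≤n
  fromDigits-< (suc N) f<ℓ = horner-< N (f<ℓ 0) (fromDigits-< N (λ t → f<ℓ (suc t)))

  suc-fromDigits-< : ∀ N .{{_ : NonZero N}} {f} → (∀ t → suc (f t) < ℓ) →
    suc (fromDigits N f) < ℓ ^ N
  suc-fromDigits-< (suc N) 1+f<ℓ =
    horner-< N (1+f<ℓ 0) (fromDigits-< N (λ t → <-trans (n<1+n _) (1+f<ℓ (suc t))))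

  fromDigits-injective-head : ∀ N .{{_ : NonZero N}} .{{_ : NonZero ℓ}} {f g} →
    (∀ t → f t < ℓ) → (∀ t → g t < ℓ) → fromDigits N f ≡ fromDigits N g → f 0 ≡ g 0
  fromDigits-injective-head (suc N) {f} {g} f<ℓ g<ℓ eq = begin
    f 0                                          ≡⟨ m<n⇒m%n≡m (f<ℓ 0) ⟨
    f 0 % ℓ                                      ≡⟨ %-remove-+ʳ (f 0) (m∣m*n _) ⟨
    fromDigits (suc N) f % ℓ                     ≡⟨ cong (_% ℓ) eq ⟩
    fromDigits (suc N) g % ℓ                     ≡⟨ %-remove-+ʳ (g 0) (m∣m*n _) ⟩
    g 0 % ℓ                                      ≡⟨ m<n⇒m%n≡m (g<ℓ 0) ⟩
    g 0                                          ∎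
    where open ≡-Reasoning

module RotationModulo (ℓ N M : ℕ) .{{_ : NonZero N}} .{{_ : NonZero M}}
                      (ℓ^N≡1+M : ℓ ^ N ≡ 1 + M) where
  open Digits ℓ

  infix 4 _≋_
  _≋_ : ℕ → ℕ → Set
  x ≋ y = x % M ≡ y % M

  ≋-*ˡ : ∀ c {x y} → x ≋ y → c * x ≋ c * y
  ≋-*ˡ c {x} {y} x≋y = begin
    c * x % M                ≡⟨ %-distribˡ-* c x M ⟩
    (c % M) * (x % M) % M    ≡⟨ cong (λ z → (c % M) * z % M) x≋y ⟩
    (c % M) * (y % M) % M    ≡⟨ %-distribˡ-* c y M ⟨
    c * y % M                ∎
    where open ≡-Reasoning

  ≋-<⇒≡ : ∀ {x y} → x < M → y < M → x ≋ y → x ≡ y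
  ≋-<⇒≡ x<M y<M x≋y = trans (sym (m<n⇒m%n≡m x<M)) (trans x≋y (m<n⇒m%n≡m y<M))

  ℓ^N*-≋ : ∀ x → ℓ ^ N * x ≋ x
  ℓ^N*-≋ x = begin
    ℓ ^ N * x % M      ≡⟨ cong (λ p → p * x % M) ℓ^N≡1+M ⟩
    (x + M * x) % M    ≡⟨ %-remove-+ʳ x (m∣m*n x) ⟩
    x % M              ∎
    where open ≡-Reasoning

  ℓ*-cancel-≋ : ∀ {x y} → ℓ * x ≋ ℓ * y → x ≋ y
  ℓ*-cancel-≋ {x} {y} ℓx≋ℓy = begin
    x % M                          ≡⟨ ℓ^N*-≋ x ⟨
    ℓ ^ N * x % M                  ≡⟨ cong (_% M) (peel x) ⟩
    ℓ ^ pred N * (ℓ * x) % M       ≡⟨ ≋-*ˡ (ℓ ^ pred N) ℓx≋ℓy ⟩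
    ℓ ^ pred N * (ℓ * y) % M       ≡⟨ cong (_% M) (peel y) ⟨
    ℓ ^ N * y % M                  ≡⟨ ℓ^N*-≋ y ⟩
    y % M                          ∎
    where
    open ≡-Reasoning
    peel : ∀ z → ℓ ^ N * z ≡ ℓ ^ pred N * (ℓ * z)
    peel z = trans (cong (λ e → ℓ ^ e * z) (sym (suc-pred N))) (lemma ℓ (ℓ ^ pred N) z)
      where
      lemma : ∀ l p z → l * p * z ≡ p * (l * z)
      lemma = solve-∀

  ℓ^*-cancel-≋ : ∀ j {x y} → ℓ ^ j * x ≋ ℓ ^ j * y → x ≋ y
  ℓ^*-cancel-≋ zero    {x} {y} x≋y =
    trans (cong (_% M) (sym (*-identityˡ x))) (trans x≋y (cong (_% M) (*-identityˡ y)))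
  ℓ^*-cancel-≋ (suc j) {x} {y} e = ℓ^*-cancel-≋ j (ℓ*-cancel-≋ (begin
    ℓ * (ℓ ^ j * x) % M    ≡⟨ cong (_% M) (*-assoc ℓ (ℓ ^ j) x) ⟨
    ℓ ^ suc j * x % M      ≡⟨ e ⟩
    ℓ ^ suc j * y % M      ≡⟨ cong (_% M) (*-assoc ℓ (ℓ ^ j) y) ⟩
    ℓ * (ℓ ^ j * y) % M    ∎))
    where open ≡-Reasoning

  ℓ*-rotate-≋ : ∀ f → f N ≡ f 0 → ℓ * fromDigits N (λ t → f (suc t)) ≋ fromDigits N f
  ℓ*-rotate-≋ f fN≡f0 = trans (cong (_% M) shifted) (%-remove-+ʳ V (m∣m*n (f 0)))
    where
    V = fromDigits N f
    V' = fromDigits N (λ t → f (suc t))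
    shifted : ℓ * V' ≡ V + M * f 0
    shifted = +-cancelˡ-≡ (f 0) _ _ (begin
      f 0 + ℓ * V'          ≡⟨ fromDigits-rotate N f ⟨
      V + ℓ ^ N * f N       ≡⟨ cong₂ (λ p z → V + p * z) ℓ^N≡1+M fN≡f0 ⟩
      V + (1 + M) * f 0     ≡⟨ lemma V M (f 0) ⟩
      f 0 + (V + M * f 0)   ∎)
      where
      open ≡-Reasoning
      lemma : ∀ v m a → v + (1 + m) * a ≡ a + (v + m * a)
      lemma = solve-∀

  ℓ^*-rotate-≋ : ∀ {f} → Periodic N f → ∀ d →
    ℓ ^ d * fromDigits N (λ t → f (d + t)) ≋ fromDigits N f
  ℓ^*-rotate-≋ {f} per zero = cong (_% M) (*-identityˡ _)
  ℓ^*-rotate-≋ {f} per (suc d) = begin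
    ℓ * ℓ ^ d * fromDigits N (λ t → f (suc (d + t))) % M
      ≡⟨ cong (_% M) (*-assoc ℓ (ℓ ^ d) _) ⟩
    ℓ * (ℓ ^ d * fromDigits N (λ t → f (suc (d + t)))) % M
      ≡⟨ ≋-*ˡ ℓ (ℓ^*-rotate-≋ (λ t → trans (cong f (sym (+-suc N t))) (per (suc t))) d) ⟩
    ℓ * fromDigits N (λ t → f (suc t)) % M
      ≡⟨ ℓ*-rotate-≋ f (trans (cong f (sym (+-identityʳ N))) (per 0)) ⟩
    fromDigits N f % M ∎
    where open ≡-Reasoning

  rotations-≋⇒digit≡ : ∀ {f g} → Periodic N f → (∀ t → suc (f t) < ℓ) → (∀ t → suc (g t) < ℓ) →
    ∀ {j j'} → j ≤ j' → ℓ ^ j * fromDigits N f ≋ ℓ ^ j' * fromDigits N g → f (j' ∸ j) ≡ g 0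
  rotations-≋⇒digit≡ {f} {g} per 1+f<ℓ 1+g<ℓ {j} {j'} j≤j' e =
    trans (cong f (sym (+-identityʳ d)))
      (fromDigits-injective-head N (λ t → digit< 1+f<ℓ (d + t)) (digit< 1+g<ℓ)
        (≋-<⇒≡ (reduced (λ t → f (d + t)) (λ t → 1+f<ℓ (d + t))) (reduced g 1+g<ℓ)
          (ℓ^*-cancel-≋ j' shifted)))
    where
    d = j' ∸ j
    instance
      ℓ-nonZero : NonZero ℓ
      ℓ-nonZero = >-nonZero (<-trans z<s (1+f<ℓ 0))
    digit< : ∀ {h : ℕ → ℕ} → (∀ t → suc (h t) < ℓ) → ∀ t → h t < ℓ
    digit< 1+h<ℓ t = <-trans (n<1+n _) (1+h<ℓ t)
    reduced : ∀ h → (∀ t → suc (h t) < ℓ) → fromDigits N h < M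
    reduced h 1+h<ℓ = s≤s⁻¹ (subst (suc (fromDigits N h) <_) ℓ^N≡1+M (suc-fromDigits-< N 1+h<ℓ))
    shifted : ℓ ^ j' * fromDigits N (λ t → f (d + t)) ≋ ℓ ^ j' * fromDigits N g
    shifted = begin
      ℓ ^ j' * fromDigits N (λ t → f (d + t)) % M
        ≡⟨ cong (λ e → ℓ ^ e * fromDigits N (λ t → f (d + t)) % M) (m+[n∸m]≡n j≤j') ⟨
      ℓ ^ (j + d) * fromDigits N (λ t → f (d + t)) % M
        ≡⟨ cong (λ p → p * fromDigits N (λ t → f (d + t)) % M) (^-distribˡ-+-* ℓ j d) ⟩
      ℓ ^ j * ℓ ^ d * fromDigits N (λ t → f (d + t)) % M
        ≡⟨ cong (_% M) (*-assoc (ℓ ^ j) (ℓ ^ d) _) ⟩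
      ℓ ^ j * (ℓ ^ d * fromDigits N (λ t → f (d + t))) % M
        ≡⟨ ≋-*ˡ (ℓ ^ j) (ℓ^*-rotate-≋ per d) ⟩
      ℓ ^ j * fromDigits N f % M
        ≡⟨ e ⟩
      ℓ ^ j' * fromDigits N g % M ∎
      where open ≡-Reasoning

module _ {c ℓ'} (G : AbelianGroup c ℓ') where
  open AbelianGroup G using (_≈_; _∙_; ε; monoid; group; reflexive)
    renaming (sym to ≈-sym; trans to ≈-trans)
  open MonoidMult monoid using (_×_; ×-homo-+; ×-assocˡ; ×-congʳ)
  open GroupProperties group using (identityʳ-unique)

  gpow≡× : ∀ x m → gpow G x m ≡ m × x
  gpow≡× x zero    = refl
  gpow≡× x (suc m) = cong (x ∙_) (gpow≡× x m)

  gpow-+ : ∀ x m n → gpow G x (m + n) ≈ gpow G x m ∙ gpow G x n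
  gpow-+ x m n rewrite gpow≡× x (m + n) | gpow≡× x m | gpow≡× x n = ×-homo-+ x m n

  gpow-* : ∀ x m n → gpow G x (m * n) ≈ gpow G (gpow G x m) n
  gpow-* x m n rewrite gpow≡× x (m * n) | gpow≡× (gpow G x m) n | gpow≡× x m =
    ≈-trans (reflexive (cong (_× x) (*-comm m n))) (≈-sym (×-assocˡ x n m))

  gpow-cong : ∀ m {x y} → x ≈ y → gpow G x m ≈ gpow G y m
  gpow-cong m {x} {y} x≈y rewrite gpow≡× x m | gpow≡× y m = ×-congʳ m x≈y

  module _ {g M} .{{_ : NonZero M}} (ord : ∀ m → gpow G g m ≈ ε → M ∣ m) where

    gpow-≈⇒%≡-≥ : ∀ {A B} → B ≤ A → gpow G g A ≈ gpow G g B → A % M ≡ B % M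
    gpow-≈⇒%≡-≥ {A} {B} B≤A gA≈gB = begin
      A % M              ≡⟨ cong (_% M) (m+[n∸m]≡n B≤A) ⟨
      (B + (A ∸ B)) % M  ≡⟨ %-remove-+ʳ B (ord (A ∸ B) g^[A∸B]≈ε) ⟩
      B % M              ∎
      where
      open ≡-Reasoning
      g^[A∸B]≈ε : gpow G g (A ∸ B) ≈ ε
      g^[A∸B]≈ε = identityʳ-unique (gpow G g B) _
        (≈-trans (≈-sym (gpow-+ g B (A ∸ B)))
          (≈-trans (reflexive (cong (gpow G g) (m+[n∸m]≡n B≤A))) gA≈gB))

    gpow-≈⇒%≡ : ∀ {A B} → gpow G g A ≈ gpow G g B → A % M ≡ B % M
    gpow-≈⇒%≡ {A} {B} gA≈gB with ≤-total A B
    ... | inj₁ A≤B = sym (gpow-≈⇒%≡-≥ A≤B (≈-sym gA≈gB))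
    ... | inj₂ B≤A = gpow-≈⇒%≡-≥ B≤A gA≈gB

  ψ-lift : ∀ {ℓ ψ} .{{_ : NonZero ℓ}} → FundamentalChars G ℓ ψ → ∀ {r m} → 1 ≤ r → 1 ≤ m →
    gpow G (ψ (r * m)) (repunit (ℓ ^ r) m) ≈ ψ r
  ψ-lift {ℓ} FC {r} {m} 1≤r 1≤m =
    FundamentalChars.compat FC r m (repunit (ℓ ^ r) m) 1≤r 1≤m (begin
      repunit (ℓ ^ r) m * (ℓ ^ r ∸ 1)  ≡⟨ repunit-*-pred (ℓ ^ r) m (m^n>0 ℓ r) ⟩
      (ℓ ^ r) ^ m ∸ 1                  ≡⟨ cong (_∸ 1) (^-*-assoc ℓ r m) ⟩
      ℓ ^ (r * m) ∸ 1                  ∎)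
    where open ≡-Reasoning

Σ-≡-toℕ : ∀ {s} {r : Fin s → ℕ} {i i'} {j : Fin (r i)} {j' : Fin (r i')} →
  i ≡ i' → toℕ j ≡ toℕ j' → _≡_ {A = Σ (Fin s) (λ i → Fin (r i))} (i , j) (i' , j')
Σ-≡-toℕ refl toℕj≡toℕj' = cong (_ ,_) (toℕ-injective toℕj≡toℕj')

toℕ-mod : ∀ m n .{{_ : NonZero n}} → m < n → toℕ (m mod n) ≡ m
toℕ-mod m n m<n = trans (toℕ-fromℕ< _) (m<n⇒m%n≡m m<n)

module _ {c ℓ'} (G : AbelianGroup c ℓ') {ℓ n k : ℕ} (k*n!+1<ℓ : k * n ! + 1 < ℓ)
         {ψ : ℕ → AbelianGroup.Carrier G} (FC : FundamentalChars G ℓ ψ) (D : RegularData ℓ n k) where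
  open AbelianGroup G using (_≈_; setoid) renaming (sym to ≈-sym; trans to ≈-trans)
  open RegularData D
  open Digits ℓ

  1<ℓ : 1 < ℓ
  1<ℓ = ≤-<-trans (m≤n+m 1 (k * n !)) k*n!+1<ℓ

  instance
    ℓ-nonZero : NonZero ℓ
    ℓ-nonZero = >-nonZero (<-trans z<s 1<ℓ)
    r-nonZero : ∀ {i} → NonZero (r i)
    r-nonZero {i} = >-nonZero (r-pos i)
    n!-nonZero : NonZero (n !)
    n!-nonZero = >-nonZero (1≤n! n)

  weights : Fin s → ℕ → ℕ
  weights i t = a i (t mod r i)

  weights-periodic : ∀ i → Periodic (r i) (weights i)
  weights-periodic i t = cong (a i) (toℕ-injective (begin
    toℕ ((r i + t) mod r i)  ≡⟨ toℕ-fromℕ< _ ⟩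
    (r i + t) % r i          ≡⟨ %-remove-+ˡ t (∣-refl {r i}) ⟩
    t % r i                  ≡⟨ toℕ-fromℕ< _ ⟨
    toℕ (t mod r i)          ∎))
    where open ≡-Reasoning

  b≡fromDigits : ∀ i → b i ≡ fromDigits (r i) (weights i)
  b≡fromDigits i =
    trans (sumFin-cong (r i) (λ j → cong (λ j′ → a i j′ * ℓ ^ toℕ j) (sym (mod-toℕ j))))
          (sumFin-≡-fromDigits (r i) (weights i))
    where
    mod-toℕ : (j : Fin (r i)) → toℕ j mod r i ≡ j
    mod-toℕ j = toℕ-injective (toℕ-mod (toℕ j) (r i) (toℕ<n j))

  n!*weights : Fin s → ℕ → ℕ
  n!*weights i t = n ! * weights i t

  n!*weights-periodic : ∀ i m → Periodic (r i * m) (n!*weights i)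
  n!*weights-periodic i m t = cong (n ! *_) (periodic-* (weights-periodic i) m t)

  suc-n!*weights<ℓ : ∀ i t → suc (n!*weights i t) < ℓ
  suc-n!*weights<ℓ i t = begin-strict
    1 + n ! * weights i t  ≤⟨ +-monoʳ-≤ 1 (*-monoʳ-≤ (n !) (a≤k i _)) ⟩
    1 + n ! * k            ≡⟨ cong (1 +_) (*-comm (n !) k) ⟩
    1 + k * n !            ≡⟨ +-comm 1 (k * n !) ⟩
    k * n ! + 1            <⟨ k*n!+1<ℓ ⟩
    ℓ                      ∎
    where open ≤-Reasoning

  diagChar-exponent : ∀ i (j : Fin (r i)) m →
    repunit (ℓ ^ r i) m * (b i * ℓ ^ toℕ j) * n ! ≡
    ℓ ^ toℕ j * fromDigits (r i * m) (n!*weights i)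
  diagChar-exponent i j m = begin
    q * (b i * x) * n !                             ≡⟨ lemma q (b i) x (n !) ⟩
    x * (n ! * (b i * q))                           ≡⟨ cong (λ y → x * (n ! * (y * q))) (b≡fromDigits i) ⟩
    x * (n ! * (fromDigits (r i) (weights i) * q))  ≡⟨ cong (λ y → x * (n ! * y)) periodic ⟨
    x * (n ! * fromDigits (r i * m) (weights i))    ≡⟨ cong (x *_) scaled ⟨
    x * fromDigits (r i * m) (n!*weights i)         ∎
    where
    open ≡-Reasoning
    q = repunit (ℓ ^ r i) m
    x = ℓ ^ toℕ j
    periodic = fromDigits-periodic (r i) m (weights i) (weights-periodic i)
    scaled = fromDigits-scale (r i * m) (n !) (weights i)
    lemma : ∀ q b x c → q * (b * x) * c ≡ x * (c * (b * q))
    lemma = solve-∀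

  diagChar^n! : ∀ i j {m N} → 1 ≤ m → r i * m ≡ N →
    gpow G (diagChar G ψ D i j) (n !) ≈ gpow G (ψ N) (ℓ ^ toℕ j * fromDigits N (n!*weights i))
  diagChar^n! i j {m} 1≤m refl = begin
    gpow G (gpow G (ψ (r i)) (b i * x)) (n !)
      ≈⟨ gpow-cong G (n !) (gpow-cong G (b i * x) (≈-sym (ψ-lift G FC (r-pos i) 1≤m))) ⟩
    gpow G (gpow G (gpow G (ψ (r i * m)) q) (b i * x)) (n !)
      ≈⟨ gpow-cong G (n !) (gpow-* G (ψ (r i * m)) q (b i * x)) ⟨
    gpow G (gpow G (ψ (r i * m)) (q * (b i * x))) (n !)
      ≈⟨ gpow-* G (ψ (r i * m)) (q * (b i * x)) (n !) ⟨
    gpow G (ψ (r i * m)) (q * (b i * x) * n !)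
      ≡⟨ cong (gpow G (ψ (r i * m))) (diagChar-exponent i j m) ⟩
    gpow G (ψ (r i * m)) (x * fromDigits (r i * m) (n!*weights i)) ∎
    where
    open SetoidReasoning setoid
    q = repunit (ℓ ^ r i) m
    x = ℓ ^ toℕ j

  diagChar^n!-≈⇒weights≡ : ∀ i j i' j' → toℕ j ≤ toℕ j' →
    gpow G (diagChar G ψ D i j) (n !) ≈ gpow G (diagChar G ψ D i' j') (n !) →
    weights i (toℕ j' ∸ toℕ j) ≡ weights i' 0
  diagChar^n!-≈⇒weights≡ i j i' j' j≤j' χ≈χ' =
    *-cancelˡ-≡ _ _ (n !) (RotationModulo.rotations-≋⇒digit≡ ℓ N M ℓ^N≡1+M
      (n!*weights-periodic i (r i')) (suc-n!*weights<ℓ i) (suc-n!*weights<ℓ i') j≤j'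
      (gpow-≈⇒%≡ G (Equivalence.to ∘ FundamentalChars.order FC N 1≤N)
        (≈-trans (≈-sym (diagChar^n! i j (r-pos i') refl))
          (≈-trans χ≈χ' (diagChar^n! i' j' (r-pos i) (*-comm (r i') (r i)))))))
    where
    N = r i * r i'
    M = ℓ ^ N ∸ 1
    1≤N : 1 ≤ N
    1≤N = *-mono-≤ (r-pos i) (r-pos i')
    ℓ^N≡1+M : ℓ ^ N ≡ 1 + M
    ℓ^N≡1+M = sym (m+[n∸m]≡n (m^n>0 ℓ N))
    instance
      N-nonZero : NonZero N
      N-nonZero = >-nonZero 1≤N
      M-nonZero : NonZero M
      M-nonZero = >-nonZero (s≤s⁻¹ (subst (1 <_) ℓ^N≡1+M (^-monoʳ-< ℓ 1<ℓ 1≤N)))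

  diagChar^n!-injective : ∀ i j i' j' → toℕ j ≤ toℕ j' →
    gpow G (diagChar G ψ D i j) (n !) ≈ gpow G (diagChar G ψ D i' j') (n !) →
    _≡_ {A = Σ (Fin s) (λ i → Fin (r i))} (i , j) (i' , j')
  diagChar^n!-injective i j i' j' j≤j' χ≈χ' = Σ-≡-toℕ i≡i' (≤-antisym j≤j' (m∸n≡0⇒m≤n d≡0))
    where
    d = toℕ j' ∸ toℕ j
    sameWeight : (i , d mod r i) ≡ (i' , 0 mod r i')
    sameWeight = a-inj _ _ _ _ (diagChar^n!-≈⇒weights≡ i j i' j' j≤j' χ≈χ')
    i≡i' : i ≡ i'
    i≡i' = cong proj₁ sameWeight
    d<r : d < r i
    d<r = ≤-<-trans (m∸n≤m (toℕ j') (toℕ j)) (subst (λ i → toℕ j' < r i) (sym i≡i') (toℕ<n j'))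
    d≡0 : d ≡ 0
    d≡0 = begin
      d                  ≡⟨ toℕ-mod d (r i) d<r ⟨
      toℕ (d mod r i)    ≡⟨ cong (toℕ ∘ proj₂) sameWeight ⟩
      toℕ (0 mod r i')   ≡⟨ toℕ-mod 0 (r i') (r-pos i') ⟩
      0                  ∎
      where open ≡-Reasoning

lemma3p3 : ∀ {c ℓ'} (G : AbelianGroup c ℓ') (ℓ n k : ℕ) → Prime ℓ →
    k * (n !) + 1 < ℓ →
    (ψ : ℕ → AbelianGroup.Carrier G) → FundamentalChars G ℓ ψ →
    (D : RegularData ℓ n k) →
    ∀ i j i' j' →
    ¬ (_≡_ {A = Σ (Fin (RegularData.s D)) (λ i → Fin (RegularData.r D i))} (i , j) (i' , j')) →
    ¬ (AbelianGroup._≈_ G (gpow G (diagChar G ψ D i j) (n !))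
                          (gpow G (diagChar G ψ D i' j') (n !)))
lemma3p3 G ℓ n k _ k*n!+1<ℓ ψ FC D i j i' j' ij≢i'j' χ≈χ' with ≤-total (toℕ j) (toℕ j')
... | inj₁ j≤j' = ij≢i'j' (diagChar^n!-injective G k*n!+1<ℓ FC D i j i' j' j≤j' χ≈χ')
... | inj₂ j'≤j =
  ij≢i'j' (sym (diagChar^n!-injective G k*n!+1<ℓ FC D i' j' i j j'≤j (AbelianGroup.sym G χ≈χ')))
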